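{- There is no isomorphism-invariant class of countable linear orderings containing only countably many isomorphism types that is $4$-universal for the class of all countable linear orderings.
   Context: Let $K_0\subseteq K_1$ be isomorphism-invariant classes of countable structures. $K_0$ is $\alpha$-universal for $K_1$ if for every $\mathcal{A}\in K_1$ there is $\mathcal{B}\in K_0$ with $\mathcal{A}\le_\alpha\mathcal{B}$. Here $\mathcal{A}\le_\alpha\mathcal{B}$ means every $\Pi^{\mathrm{in}}_\alpha$ sentence true in $\mathcal{A}$ is true in $\mathcal{B}$, where $\Pi^{\mathrm{in}}_0$ are the finitary quantifier-free formulas and $\Pi^{\mathrm{in}}_\alpha$ formulas are countable conjunctions of $\forall\bar x\,\varphi$ with $\varphi$ a $\Sigma^{\mathrm{in}}_\gamma$ formula, $\gamma<\alpha$ ($\Sigma^{\mathrm{in}}_\gamma$ dual). -}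

module Defs where

open import Level using (0ℓ)
open import Data.Nat using (ℕ; zero; suc; _+_; _≤_)
open import Data.Fin using (Fin)
open import Data.Maybe using (Maybe; just; nothing)
open import Data.Product using (Σ; _×_; _,_; ∃)
open import Data.Sum using (_⊎_)
open import Data.Unit using (⊤)
open import Data.Empty using (⊥)
open import Relation.Nullary using (¬_)
open import Relation.Binary.PropositionalEquality using (_≡_)
open import Function using (Injective; Bijective)
open import Data.Vec.Functional using (Vector; _++_)

-- Countable linear orderings (strict order <, countable = injects into ℕ;
-- finite and empty orderings are included).

record LinOrd : Set₁ where
  field
    Carrier  : Set
    _<_      : Carrier → Carrier → Set
    irrefl   : ∀ x → ¬ (x < x)
    trans<   : ∀ {x y z} → x < y → y < z → x < z
    trichot  : ∀ x y → (x < y) ⊎ ((x ≡ y) ⊎ (y < x))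
    code     : Carrier → ℕ
    code-inj : Injective _≡_ _≡_ code

open LinOrd public

_≅_ : LinOrd → LinOrd → Set
A ≅ B = Σ (Carrier A → Carrier B) λ f →
          Bijective _≡_ _≡_ f ×
          (∀ x y → (_<_ A x y → _<_ B (f x) (f y)) × (_<_ B (f x) (f y) → _<_ A x y))

data QF (n : ℕ) : Set where
  eqA  : Fin n → Fin n → QF n
  ltA  : Fin n → Fin n → QF n
  negF : QF n → QF n
  andF : QF n → QF n → QF n
  orF  : QF n → QF n → QF n

-- A Π^in_{a+1} formula is a countable conjunction (indexed by ℕ, a `nothing`
-- entry meaning the conjunct is omitted, so finite/empty conjunctions are
-- allowed) of formulas ∀ x̄ φ with x̄ a block of k variables and φ a
-- Σ^in_γ formula, γ ≤ a (i.e. γ < a+1).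
data Pi : ℕ → ℕ → Set
data Sg : ℕ → ℕ → Set
data PiClause (a n : ℕ) : Set
data SgClause (a n : ℕ) : Set

data Pi where
  qfΠ   : ∀ {n} → QF n → Pi 0 n
  conjΠ : ∀ {a n} → (ℕ → Maybe (PiClause a n)) → Pi (suc a) n

data Sg where
  qfΣ   : ∀ {n} → QF n → Sg 0 n
  disjΣ : ∀ {a n} → (ℕ → Maybe (SgClause a n)) → Sg (suc a) n

data PiClause a n where
  allC : (γ : ℕ) → γ ≤ a → (k : ℕ) → Sg γ (k + n) → PiClause a n

data SgClause a n where
  exC : (γ : ℕ) → γ ≤ a → (k : ℕ) → Pi γ (k + n) → SgClause a n

-- Satisfaction (Tarskian, classical reading assumed via LEM in the theorem).

module _ (A : LinOrd) where
  private D = Carrier A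

  satQF : ∀ {n} → QF n → Vector D n → Set
  satQF (eqA i j)  ρ = ρ i ≡ ρ j
  satQF (ltA i j)  ρ = _<_ A (ρ i) (ρ j)
  satQF (negF φ)   ρ = ¬ satQF φ ρ
  satQF (andF φ ψ) ρ = satQF φ ρ × satQF ψ ρ
  satQF (orF φ ψ)  ρ = satQF φ ρ ⊎ satQF ψ ρ

  satΠ : ∀ {a n} → Pi a n → Vector D n → Set
  satΣ : ∀ {a n} → Sg a n → Vector D n → Set
  satΠC : ∀ {a n} → Maybe (PiClause a n) → Vector D n → Set
  satΣC : ∀ {a n} → Maybe (SgClause a n) → Vector D n → Set

  satΠ (qfΠ φ)   ρ = satQF φ ρ
  satΠ (conjΠ f) ρ = ∀ i → satΠC (f i) ρ
  satΣ (qfΣ φ)   ρ = satQF φ ρ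
  satΣ (disjΣ f) ρ = Σ ℕ λ i → satΣC (f i) ρ

  satΠC nothing ρ = ⊤
  satΠC (just (allC γ _ k φ)) ρ = (xs : Vector D k) → satΣ φ (xs ++ ρ)
  satΣC nothing ρ = ⊥
  satΣC (just (exC γ _ k φ)) ρ = Σ (Vector D k) λ xs → satΠ φ (xs ++ ρ)

emptyEnv : {D : Set} → Vector D 0
emptyEnv ()

_≤[_]_ : LinOrd → ℕ → LinOrd → Set
A ≤[ a ] B = (φ : Pi a 0) → satΠ A φ emptyEnv → satΠ B φ emptyEnv

Class : Set₂
Class = LinOrd → Set₁

IsoInvariant : Class → Set₁
IsoInvariant K = ∀ A B → A ≅ B → K A → K B

CountablyManyTypes : Class → Set₁
CountablyManyTypes K = Σ (ℕ → LinOrd) λ e → ∀ A → K A → Σ ℕ λ n → A ≅ e n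

UniversalFor-LO : ℕ → Class → Set₁
UniversalFor-LO a K = ∀ (A : LinOrd) → Σ LinOrd λ B → K B × (A ≤[ a ] B)

-- A block of length j+1 in a linear order is a run x₀ ⋖ x₁ ⋖ ⋯ ⋖ xⱼ of immediate
-- successors in which x₀ has no immediate predecessor and xⱼ no immediate successor.
-- Being a block is Π₂, so "some block has length j+1" is Σ₃ and "no block has length
-- j+1" is Π₃, and both are Π₄. Let e enumerate the isomorphism types of K and let
-- A = Σⱼ (Fⱼ + ℤ), where Fⱼ is empty if eⱼ has a block of length j+1 and has j+1
-- elements otherwise. The blocks of A are exactly its nonempty Fⱼ, so A has a block of
-- length n+1 iff eₙ has none; hence A ≤₄ eₙ fails for every n, whereas a 4-universal K
-- would contain some B ≅ eₙ with A ≤₄ B.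
module Submission where

open import Defs
open import Level using (Lift; lift)
open import Data.Nat as ℕ using (ℕ; zero; suc; z≤n; s≤s; _*_)
import Data.Nat.Properties as ℕ
open import Data.Integer as ℤ using (ℤ; +_; -[1+_]; 0ℤ)
import Data.Integer.Properties as ℤ
open import Data.Fin using (Fin; zero; suc; toℕ; inject₁; fromℕ; fromℕ<; cast; splitAt; _↑ˡ_)
open import Data.Fin.Properties using (toℕ-injective; toℕ<n; toℕ-fromℕ<; toℕ-inject₁; toℕ-fromℕ; toℕ-cast)
open import Data.Maybe using (Maybe; just; nothing)
open import Data.Product using (Σ; _×_; _,_; proj₁; proj₂)
open import Data.Sum using (_⊎_; inj₁; inj₂; [_,_])
open import Data.Unit using (tt)
open import Data.Empty using (⊥; ⊥-elim)
open import Data.Vec.Functional using (Vector; _++_)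
open import Data.Vec.Functional.Properties using (lookup-++ˡ)
open import Function using (Injective; _∘_; id)
open import Relation.Nullary using (¬_; Dec; yes; no)
open import Relation.Binary using (tri<; tri≈; tri>)
open import Relation.Binary.PropositionalEquality using (_≡_; refl; sym; trans; cong; subst; subst₂)
open import Axiom.ExcludedMiddle using (ExcludedMiddle)

module Transport {A B : LinOrd} (iso : A ≅ B) where

  private
    f : Carrier A → Carrier B
    f = proj₁ iso

    f-injective : ∀ {x y} → f x ≡ f y → x ≡ y
    f-injective = proj₁ (proj₁ (proj₂ iso))

    preimage : ∀ y → Σ (Carrier A) λ x → f x ≡ y
    preimage y = proj₁ (proj₂ (proj₁ (proj₂ iso)) y) , proj₂ (proj₂ (proj₁ (proj₂ iso)) y) refl

    f-mono : ∀ {x y} → _<_ A x y → _<_ B (f x) (f y)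
    f-mono = proj₁ (proj₂ (proj₂ iso) _ _)

    f-reflects : ∀ {x y} → _<_ B (f x) (f y) → _<_ A x y
    f-reflects = proj₂ (proj₂ (proj₂ iso) _ _)

  Related : ∀ {n} → Vector (Carrier A) n → Vector (Carrier B) n → Set
  Related ρ σ = ∀ i → f (ρ i) ≡ σ i

  Related-++ : ∀ {k n} {xs : Vector (Carrier A) k} {ys : Vector (Carrier B) k}
               {ρ : Vector (Carrier A) n} {σ : Vector (Carrier B) n} →
               Related xs ys → Related ρ σ → Related (xs ++ ρ) (ys ++ σ)
  Related-++ {k} xs~ys ρ~σ i with splitAt k i
  ... | inj₁ i₁ = xs~ys i₁
  ... | inj₂ i₂ = ρ~σ i₂

  satQF-transport : ∀ {n} (φ : QF n) {ρ σ} → Related ρ σ →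
                    (satQF A φ ρ → satQF B φ σ) × (satQF B φ σ → satQF A φ ρ)
  satQF-transport (eqA i j) r =
    (λ p → trans (sym (r i)) (trans (cong f p) (r j))) ,
    (λ p → f-injective (trans (r i) (trans p (sym (r j)))))
  satQF-transport (ltA i j) r =
    (λ p → subst₂ (_<_ B) (r i) (r j) (f-mono p)) ,
    (λ p → f-reflects (subst₂ (_<_ B) (sym (r i)) (sym (r j)) p))
  satQF-transport (negF φ) r =
    (λ ¬p q → ¬p (proj₂ (satQF-transport φ r) q)) ,
    (λ ¬q p → ¬q (proj₁ (satQF-transport φ r) p))
  satQF-transport (andF φ ψ) r =
    (λ (p , q) → proj₁ (satQF-transport φ r) p , proj₁ (satQF-transport ψ r) q) ,
    (λ (p , q) → proj₂ (satQF-transport φ r) p , proj₂ (satQF-transport ψ r) q)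
  satQF-transport (orF φ ψ) r =
    [ inj₁ ∘ proj₁ (satQF-transport φ r) , inj₂ ∘ proj₁ (satQF-transport ψ r) ] ,
    [ inj₁ ∘ proj₂ (satQF-transport φ r) , inj₂ ∘ proj₂ (satQF-transport ψ r) ]

  satΠ-transport  : ∀ {a n} (φ : Pi a n) {ρ σ} → Related ρ σ → satΠ A φ ρ → satΠ B φ σ
  satΣ-transport  : ∀ {a n} (φ : Sg a n) {ρ σ} → Related ρ σ → satΣ A φ ρ → satΣ B φ σ
  satΠC-transport : ∀ {a n} (c : Maybe (PiClause a n)) {ρ σ} → Related ρ σ → satΠC A c ρ → satΠC B c σ
  satΣC-transport : ∀ {a n} (c : Maybe (SgClause a n)) {ρ σ} → Related ρ σ → satΣC A c ρ → satΣC B c σ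

  satΠ-transport (qfΠ φ) r = proj₁ (satQF-transport φ r)
  satΠ-transport (conjΠ cs) r s i = satΠC-transport (cs i) r (s i)
  satΣ-transport (qfΣ φ) r = proj₁ (satQF-transport φ r)
  satΣ-transport (disjΣ cs) r (i , s) = i , satΣC-transport (cs i) r s
  satΠC-transport nothing r _ = tt
  satΠC-transport (just (allC _ _ _ φ)) r s ys =
    satΣ-transport φ (Related-++ (λ i → proj₂ (preimage (ys i))) r) (s λ i → proj₁ (preimage (ys i)))
  satΣC-transport (just (exC _ _ _ φ)) r (xs , s) =
    (λ i → f (xs i)) , satΠ-transport φ (Related-++ (λ _ → refl) r) s

≅⇒≤ : ∀ {A B a} → A ≅ B → A ≤[ a ] B
≅⇒≤ iso φ = Transport.satΠ-transport iso φ (λ ())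

module _ (L : LinOrd) where

  open LinOrd L using () renaming (Carrier to D; _<_ to _≺_)

  Between : D → D → D → Set
  Between x w y = (x ≺ w) × (w ≺ y)

  _⋖_ : D → D → Set
  x ⋖ y = (x ≺ y) × (∀ w → ¬ Between x w y)

  Separated : D → D → Set
  Separated x y = (¬ x ≺ y) ⊎ Σ D λ w → Between x w y

  NoImmediatePred NoImmediateSucc HasImmediatePred HasImmediateSucc : D → Set
  NoImmediatePred x = ∀ z → z ≺ x → Σ D λ w → Between z w x
  NoImmediateSucc x = ∀ z → x ≺ z → Σ D λ w → Between x w z
  HasImmediatePred x = Σ D λ z → z ⋖ x
  HasImmediateSucc x = Σ D λ z → x ⋖ z

  record IsBlock (j : ℕ) (c : Vector D (suc j)) : Set where
    constructor block
    field
      first-noPred : NoImmediatePred (c zero)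
      last-noSucc  : NoImmediateSucc (c (fromℕ j))
      covered      : ∀ (i : Fin j) → c (inject₁ i) ⋖ c (suc i)

  data NotBlock (j : ℕ) (c : Vector D (suc j)) : Set where
    first-hasPred : HasImmediatePred (c zero) → NotBlock j c
    last-hasSucc  : HasImmediateSucc (c (fromℕ j)) → NotBlock j c
    separated     : (i : Fin j) → Separated (c (inject₁ i)) (c (suc i)) → NotBlock j c

  NoImmediatePred⇒¬⋖ : ∀ {x z} → NoImmediatePred x → ¬ z ⋖ x
  NoImmediatePred⇒¬⋖ np (z≺x , empty) = empty _ (proj₂ (np _ z≺x))

  NoImmediateSucc⇒¬⋖ : ∀ {x z} → NoImmediateSucc x → ¬ x ⋖ z
  NoImmediateSucc⇒¬⋖ ns (x≺z , empty) = empty _ (proj₂ (ns _ x≺z))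

  ⋖⇒¬Separated : ∀ {x y} → x ⋖ y → ¬ Separated x y
  ⋖⇒¬Separated (x≺y , _) (inj₁ x⊀y) = x⊀y x≺y
  ⋖⇒¬Separated (_ , empty) (inj₂ (w , btw)) = empty w btw

  IsBlock⇒¬NotBlock : ∀ {j c} → IsBlock j c → ¬ NotBlock j c
  IsBlock⇒¬NotBlock (block np _ _)  (first-hasPred (_ , z⋖x)) = NoImmediatePred⇒¬⋖ np z⋖x
  IsBlock⇒¬NotBlock (block _ ns _)  (last-hasSucc (_ , x⋖z))  = NoImmediateSucc⇒¬⋖ ns x⋖z
  IsBlock⇒¬NotBlock (block _ _ cov) (separated i sep)         = ⋖⇒¬Separated (cov i) sep

  IsBlock-resp : ∀ {j c d} → (∀ i → c i ≡ d i) → IsBlock j c → IsBlock j d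
  IsBlock-resp {j} c≗d (block np ns cov) =
    block (subst NoImmediatePred (c≗d zero) np) (subst NoImmediateSucc (c≗d (fromℕ j)) ns)
          (λ i → subst₂ _⋖_ (c≗d (inject₁ i)) (c≗d (suc i)) (cov i))

  NotBlock-resp : ∀ {j c d} → (∀ i → c i ≡ d i) → NotBlock j c → NotBlock j d
  NotBlock-resp c≗d (first-hasPred p) = first-hasPred (subst HasImmediatePred (c≗d zero) p)
  NotBlock-resp {j} c≗d (last-hasSucc s) = last-hasSucc (subst HasImmediateSucc (c≗d (fromℕ j)) s)
  NotBlock-resp c≗d (separated i sep) = separated i (subst₂ Separated (c≗d (inject₁ i)) (c≗d (suc i)) sep)

  _≺?_ : ∀ x y → Dec (x ≺ y)
  x ≺? y with trichot L x y
  ... | inj₁ x≺y = yes x≺y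
  ... | inj₂ (inj₁ refl) = no (irrefl L x)
  ... | inj₂ (inj₂ y≺x) = no λ x≺y → irrefl L x (trans< L x≺y y≺x)

  module _ (lem : ExcludedMiddle (Level.suc Level.zero)) where

    private
      gap-or-nonempty : ∀ x y → (∀ w → ¬ Between x w y) ⊎ Σ D λ w → Between x w y
      gap-or-nonempty x y with lem {Lift _ (Σ D λ w → Between x w y)}
      ... | yes (lift btw) = inj₂ btw
      ... | no ¬btw = inj₁ λ w btw → ¬btw (lift (w , btw))

    ¬IsBlock⇒NotBlock : ∀ {j c} → ¬ IsBlock j c → NotBlock j c
    ¬IsBlock⇒NotBlock {j} {c} ¬block with lem {Lift _ (NotBlock j c)}
    ... | yes (lift nb) = nb
    ... | no ¬nb = ⊥-elim (¬block (block np ns cov))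
      where
      np : NoImmediatePred (c zero)
      np z z≺x = [ (λ empty → ⊥-elim (¬nb (lift (first-hasPred (z , z≺x , empty))))) , id ]
                   (gap-or-nonempty z (c zero))
      ns : NoImmediateSucc (c (fromℕ j))
      ns z x≺z = [ (λ empty → ⊥-elim (¬nb (lift (last-hasSucc (z , x≺z , empty))))) , id ]
                   (gap-or-nonempty (c (fromℕ j)) z)
      cov : ∀ i → c (inject₁ i) ⋖ c (suc i)
      cov i with c (inject₁ i) ≺? c (suc i) | gap-or-nonempty (c (inject₁ i)) (c (suc i))
      ... | no x⊀y | _ = ⊥-elim (¬nb (lift (separated i (inj₁ x⊀y))))
      ... | yes _ | inj₂ btw = ⊥-elim (¬nb (lift (separated i (inj₂ btw))))
      ... | yes x≺y | inj₁ empty = x≺y , empty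

lookup? : ∀ {A : Set} {j} → (Fin j → A) → ℕ → Maybe A
lookup? {j = zero}  f _       = nothing
lookup? {j = suc j} f zero    = just (f zero)
lookup? {j = suc j} f (suc i) = lookup? (f ∘ suc) i

lookup?-toℕ : ∀ {A : Set} {j} (f : Fin j → A) (k : Fin j) → lookup? f (toℕ k) ≡ just (f k)
lookup?-toℕ f zero = refl
lookup?-toℕ f (suc k) = lookup?-toℕ (f ∘ suc) k

lookup?-elim : ∀ {A : Set} {j} (P : Maybe A → Set) (f : Fin j → A) →
               P nothing → (∀ k → P (just (f k))) → ∀ i → P (lookup? f i)
lookup?-elim {j = zero}  P f p₀ pf _       = p₀
lookup?-elim {j = suc j} P f p₀ pf zero    = pf zero
lookup?-elim {j = suc j} P f p₀ pf (suc i) = lookup?-elim P (f ∘ suc) p₀ (pf ∘ suc) i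

betweenQF separatedQF coveredQF : ∀ {m} → Fin m → Fin m → Fin m → QF m
betweenQF x w y = andF (ltA x w) (ltA w y)
separatedQF x w y = orF (negF (ltA x y)) (betweenQF x w y)
coveredQF x w y = andF (ltA x y) (negF (betweenQF x w y))

-- Bound variables are de Bruijn indices in front of the free ones (cf. xs ++ ρ in satΠC),
-- so inside ∀z∃w the variable w is zero, z is suc zero and v i is suc (suc (v i)).
module _ {n : ℕ} (j : ℕ) (v : Fin (suc j) → Fin n) where

  private
    first last : Fin (suc (suc n))
    first = suc (suc (v zero))
    last  = suc (suc (v (fromℕ j)))

    ∀∃ : QF (suc (suc n)) → PiClause 1 n
    ∀∃ φ = allC 1 (s≤s z≤n) 1 (disjΣ λ _ → just (exC 0 z≤n 1 (qfΠ φ)))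

    ∃∀ : QF (suc (suc n)) → SgClause 1 n
    ∃∀ φ = exC 1 (s≤s z≤n) 1 (conjΠ λ _ → just (allC 0 z≤n 1 (qfΣ φ)))

  coveredClause : Fin j → PiClause 1 n
  coveredClause i = allC 0 z≤n 1 (qfΣ (coveredQF (suc (v (inject₁ i))) zero (suc (v (suc i)))))

  separatedClause : Fin j → SgClause 1 n
  separatedClause i = exC 0 z≤n 1 (qfΠ (separatedQF (suc (v (inject₁ i))) zero (suc (v (suc i)))))

  blockClauses : ℕ → Maybe (PiClause 1 n)
  blockClauses 0 = just (∀∃ (separatedQF (suc zero) zero first))
  blockClauses 1 = just (∀∃ (separatedQF last zero (suc zero)))
  blockClauses (suc (suc i)) = lookup? coveredClause i

  notBlockClauses : ℕ → Maybe (SgClause 1 n)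
  notBlockClauses 0 = just (∃∀ (coveredQF (suc zero) zero first))
  notBlockClauses 1 = just (∃∀ (coveredQF last zero (suc zero)))
  notBlockClauses (suc (suc i)) = lookup? separatedClause i

  blockΠ : Pi 2 n
  blockΠ = conjΠ blockClauses

  notBlockΣ : Sg 2 n
  notBlockΣ = disjΣ notBlockClauses

module _ (L : LinOrd) {n : ℕ} (j : ℕ) (v : Fin (suc j) → Fin n) (ρ : Vector (Carrier L) n) where

  private
    c : Vector (Carrier L) (suc j)
    c i = ρ (v i)

  blockΠ-sound : satΠ L (blockΠ j v) ρ → IsBlock L j c
  blockΠ-sound s = block noPred noSucc covered
    where
    noPred : NoImmediatePred L (c zero)
    noPred z z≺x with s 0 (λ _ → z)
    ... | _ , _ , inj₁ z⊀x = ⊥-elim (z⊀x z≺x)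
    ... | _ , ws , inj₂ btw = ws zero , btw
    noSucc : NoImmediateSucc L (c (fromℕ j))
    noSucc z x≺z with s 1 (λ _ → z)
    ... | _ , _ , inj₁ x⊀z = ⊥-elim (x⊀z x≺z)
    ... | _ , ws , inj₂ btw = ws zero , btw
    covered : ∀ i → _⋖_ L (c (inject₁ i)) (c (suc i))
    covered i = proj₁ (at (λ _ → c zero)) , λ w → proj₂ (at (λ _ → w))
      where
      at : satΠC L (just (coveredClause j v i)) ρ
      at = subst (λ m → satΠC L m ρ) (lookup?-toℕ (coveredClause j v) i) (s (suc (suc (toℕ i))))

  blockΠ-complete : IsBlock L j c → satΠ L (blockΠ j v) ρ
  blockΠ-complete (block noPred _ _) zero zs with _≺?_ L (zs zero) (c zero)
  ... | yes z≺x = 0 , (λ _ → proj₁ (noPred (zs zero) z≺x)) , inj₂ (proj₂ (noPred (zs zero) z≺x))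
  ... | no z⊀x = 0 , zs , inj₁ z⊀x
  blockΠ-complete (block _ noSucc _) (suc zero) zs with _≺?_ L (c (fromℕ j)) (zs zero)
  ... | yes x≺z = 0 , (λ _ → proj₁ (noSucc (zs zero) x≺z)) , inj₂ (proj₂ (noSucc (zs zero) x≺z))
  ... | no x⊀z = 0 , zs , inj₁ x⊀z
  blockΠ-complete (block _ _ covered) (suc (suc i)) =
    lookup?-elim (λ m → satΠC L m ρ) (coveredClause j v) tt
      (λ k ws → proj₁ (covered k) , proj₂ (covered k) (ws zero)) i

  notBlockΣ-sound : satΣ L (notBlockΣ j v) ρ → NotBlock L j c
  notBlockΣ-sound (0 , zs , s) = first-hasPred (zs zero , proj₁ (s 0 zs) , λ w → proj₂ (s 0 λ _ → w))
  notBlockΣ-sound (1 , zs , s) = last-hasSucc (zs zero , proj₁ (s 0 zs) , λ w → proj₂ (s 0 λ _ → w))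
  notBlockΣ-sound (suc (suc i) , s) =
    lookup?-elim (λ m → satΣC L m ρ → NotBlock L j c) (separatedClause j v) ⊥-elim
      (λ k → λ { (_ , inj₁ x⊀y) → separated k (inj₁ x⊀y)
               ; (ws , inj₂ btw) → separated k (inj₂ (ws zero , btw)) })
      i s

  notBlockΣ-complete : NotBlock L j c → satΣ L (notBlockΣ j v) ρ
  notBlockΣ-complete (first-hasPred (z , z≺x , empty)) = 0 , (λ _ → z) , λ _ ws → z≺x , empty (ws zero)
  notBlockΣ-complete (last-hasSucc (z , x≺z , empty)) = 1 , (λ _ → z) , λ _ ws → x≺z , empty (ws zero)
  notBlockΣ-complete (separated k sep) =
    suc (suc (toℕ k)) ,
    subst (λ m → satΣC L m ρ) (sym (lookup?-toℕ (separatedClause j v) k)) (witness sep)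
    where
    witness : Separated L (c (inject₁ k)) (c (suc k)) → satΣC L (just (separatedClause j v k)) ρ
    witness (inj₁ x⊀y) = (λ _ → c zero) , inj₁ x⊀y
    witness (inj₂ (w , btw)) = (λ _ → w) , inj₂ btw

hasBlock noBlock : ℕ → Pi 4 0
hasBlock j = conjΠ λ _ → just (allC 3 (s≤s (s≤s (s≤s z≤n))) 0
               (disjΣ λ _ → just (exC 2 (s≤s (s≤s z≤n)) (suc j) (blockΠ j (_↑ˡ 0)))))
noBlock j = conjΠ λ _ → just (allC 2 (s≤s (s≤s z≤n)) (suc j) (notBlockΣ j (_↑ˡ 0)))

module _ (L : LinOrd) (j : ℕ) where

  hasBlock-sound : satΠ L (hasBlock j) emptyEnv → Σ (Vector (Carrier L) (suc j)) (IsBlock L j)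
  hasBlock-sound s with s 0 emptyEnv
  ... | _ , c , sat = c , IsBlock-resp L (lookup-++ˡ c _) (blockΠ-sound L j (_↑ˡ 0) _ sat)

  hasBlock-complete : Σ (Vector (Carrier L) (suc j)) (IsBlock L j) → satΠ L (hasBlock j) emptyEnv
  hasBlock-complete (c , c-block) _ xs =
    0 , c , blockΠ-complete L j (_↑ˡ 0) _ (IsBlock-resp L (sym ∘ lookup-++ˡ c (xs ++ emptyEnv)) c-block)

  noBlock-sound : satΠ L (noBlock j) emptyEnv → ∀ c → NotBlock L j c
  noBlock-sound s c = NotBlock-resp L (lookup-++ˡ c emptyEnv) (notBlockΣ-sound L j (_↑ˡ 0) _ (s 0 c))

  noBlock-complete : (∀ c → NotBlock L j c) → satΠ L (noBlock j) emptyEnv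
  noBlock-complete notBlock _ cs =
    notBlockΣ-complete L j (_↑ˡ 0) (cs ++ emptyEnv) (notBlock λ i → (cs ++ emptyEnv) (i ↑ˡ 0))

pair : ℕ → ℕ → ℕ
pair zero    b = suc (2 * b)
pair (suc a) b = 2 * pair a b

pair-injective : ∀ {a b a′ b′} → pair a b ≡ pair a′ b′ → a ≡ a′ × b ≡ b′
pair-injective {zero}  {b} {zero}   {b′} eq = refl , ℕ.*-cancelˡ-≡ b b′ 2 (ℕ.suc-injective eq)
pair-injective {zero}  {b} {suc a′} {b′} eq = ⊥-elim (ℕ.even≢odd (pair a′ b′) b (sym eq))
pair-injective {suc a} {b} {zero}   {b′} eq = ⊥-elim (ℕ.even≢odd (pair a b) b′ eq)
pair-injective {suc a} {b} {suc a′} {b′} eq with pair-injective {a} {b} {a′} {b′} (ℕ.*-cancelˡ-≡ (pair a b) _ 2 eq)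
... | refl , b≡b′ = refl , b≡b′

⊎-code : ∀ {A B : Set} → (A → ℕ) → (B → ℕ) → A ⊎ B → ℕ
⊎-code f g (inj₁ a) = 2 * f a
⊎-code f g (inj₂ b) = suc (2 * g b)

⊎-code-injective : ∀ {A B : Set} {f : A → ℕ} {g : B → ℕ} →
                   Injective _≡_ _≡_ f → Injective _≡_ _≡_ g → Injective _≡_ _≡_ (⊎-code f g)
⊎-code-injective {f = f} f-inj g-inj {inj₁ a} {inj₁ a′} eq = cong inj₁ (f-inj (ℕ.*-cancelˡ-≡ (f a) _ 2 eq))
⊎-code-injective {f = f} {g} f-inj g-inj {inj₁ a} {inj₂ b′} eq = ⊥-elim (ℕ.even≢odd (f a) (g b′) eq)
⊎-code-injective {f = f} {g} f-inj g-inj {inj₂ b} {inj₁ a′} eq = ⊥-elim (ℕ.even≢odd (f a′) (g b) (sym eq))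
⊎-code-injective {g = g} f-inj g-inj {inj₂ b} {inj₂ b′} eq =
  cong inj₂ (g-inj (ℕ.*-cancelˡ-≡ (g b) _ 2 (ℕ.suc-injective eq)))

ℤ-code : ℤ → ℕ
ℤ-code (+ n)    = 2 * n
ℤ-code -[1+ n ] = suc (2 * n)

ℤ-code-injective : Injective _≡_ _≡_ ℤ-code
ℤ-code-injective {+ m}      {+ n}      eq = cong +_ (ℕ.*-cancelˡ-≡ m n 2 eq)
ℤ-code-injective {+ m}      { -[1+ n ]} eq = ⊥-elim (ℕ.even≢odd m n eq)
ℤ-code-injective { -[1+ m ]} {+ n}      eq = ⊥-elim (ℕ.even≢odd n m (sym eq))
ℤ-code-injective { -[1+ m ]} { -[1+ n ]} eq = cong -[1+_] (ℕ.*-cancelˡ-≡ m n 2 (ℕ.suc-injective eq))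

pred<self : ∀ u → ℤ.pred u ℤ.< u
pred<self u = ℤ.i≤pred[j]⇒i<j ℤ.≤-refl

self<suc : ∀ u → u ℤ.< ℤ.suc u
self<suc u = ℤ.suc[i]≤j⇒i<j ℤ.≤-refl

module BlockSum (size : ℕ → ℕ) where

  Element : Set
  Element = Σ ℕ λ j → Fin (size j) ⊎ ℤ

  data _≺_ : Element → Element → Set where
    block< : ∀ {j j′ a b} → j ℕ.< j′ → (j , a) ≺ (j′ , b)
    fin<   : ∀ {j} {x y : Fin (size j)} → toℕ x ℕ.< toℕ y → (j , inj₁ x) ≺ (j , inj₁ y)
    fin<ℤ  : ∀ {j x u} → (j , inj₁ x) ≺ (j , inj₂ u)
    ℤ<     : ∀ {j u u′} → u ℤ.< u′ → (j , inj₂ u) ≺ (j , inj₂ u′)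

  ≺-irrefl : ∀ x → ¬ x ≺ x
  ≺-irrefl _ (block< p) = ℕ.<-irrefl refl p
  ≺-irrefl _ (fin< p)   = ℕ.<-irrefl refl p
  ≺-irrefl _ (ℤ< p)     = ℤ.<-irrefl refl p

  ≺-trans : ∀ {x y z} → x ≺ y → y ≺ z → x ≺ z
  ≺-trans (block< p) (block< q) = block< (ℕ.<-trans p q)
  ≺-trans (block< p) (fin< _)   = block< p
  ≺-trans (block< p) fin<ℤ      = block< p
  ≺-trans (block< p) (ℤ< _)     = block< p
  ≺-trans (fin< _)   (block< q) = block< q
  ≺-trans fin<ℤ      (block< q) = block< q
  ≺-trans (ℤ< _)     (block< q) = block< q
  ≺-trans (fin< p)   (fin< q)   = fin< (ℕ.<-trans p q)
  ≺-trans (fin< _)   fin<ℤ      = fin<ℤ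
  ≺-trans fin<ℤ      (ℤ< _)     = fin<ℤ
  ≺-trans (ℤ< p)     (ℤ< q)     = ℤ< (ℤ.<-trans p q)

  ≺-trichotomous : ∀ x y → x ≺ y ⊎ (x ≡ y ⊎ y ≺ x)
  ≺-trichotomous (j , a) (j′ , b) with ℕ.<-cmp j j′
  ... | tri< p _ _ = inj₁ (block< p)
  ... | tri> _ _ p = inj₂ (inj₂ (block< p))
  ≺-trichotomous (j , inj₁ x) (.j , inj₁ y) | tri≈ _ refl _ with ℕ.<-cmp (toℕ x) (toℕ y)
  ... | tri< p _ _ = inj₁ (fin< p)
  ... | tri≈ _ e _ = inj₂ (inj₁ (cong (λ t → j , inj₁ t) (toℕ-injective e)))
  ... | tri> _ _ p = inj₂ (inj₂ (fin< p))
  ≺-trichotomous (j , inj₁ x) (.j , inj₂ u) | tri≈ _ refl _ = inj₁ fin<ℤ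
  ≺-trichotomous (j , inj₂ u) (.j , inj₁ y) | tri≈ _ refl _ = inj₂ (inj₂ fin<ℤ)
  ≺-trichotomous (j , inj₂ u) (.j , inj₂ u′) | tri≈ _ refl _ with ℤ.<-cmp u u′
  ... | tri< p _ _ = inj₁ (ℤ< p)
  ... | tri≈ _ e _ = inj₂ (inj₁ (cong (λ t → j , inj₂ t) e))
  ... | tri> _ _ p = inj₂ (inj₂ (ℤ< p))

  code′ : Element → ℕ
  code′ (j , t) = pair j (⊎-code toℕ ℤ-code t)

  code′-injective : Injective _≡_ _≡_ code′
  code′-injective {j , t} {j′ , t′} eq with pair-injective {j} {_} {j′} eq
  ... | refl , t≡t′ = cong (j ,_) (⊎-code-injective toℕ-injective ℤ-code-injective t≡t′)

  ordering : LinOrd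
  ordering = record
    { Carrier = Element ; _<_ = _≺_ ; irrefl = ≺-irrefl ; trans< = ≺-trans
    ; trichot = ≺-trichotomous ; code = code′ ; code-inj = code′-injective }

  fin-⋖ : ∀ {j} {x y : Fin (size j)} → toℕ y ≡ suc (toℕ x) → _⋖_ ordering (j , inj₁ x) (j , inj₁ y)
  fin-⋖ {j} {x} {y} y≡1+x = fin< (subst (toℕ x ℕ.<_) (sym y≡1+x) ℕ.≤-refl) , nothing-between
    where
    nothing-between : ∀ w → ¬ Between ordering (j , inj₁ x) w (j , inj₁ y)
    nothing-between _ (block< p , block< q) = ℕ.<-asym p q
    nothing-between _ (block< p , fin< _)   = ℕ.<-irrefl refl p
    nothing-between _ (fin< _   , block< q) = ℕ.<-irrefl refl q
    nothing-between _ (fin<ℤ    , block< q) = ℕ.<-irrefl refl q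
    nothing-between (_ , inj₁ w) (fin< p , fin< q) =
      ℕ.<-irrefl refl (ℕ.<-≤-trans q (subst (ℕ._≤ toℕ w) (sym y≡1+x) p))

  ℤ-⋖ : ∀ {j} u → _⋖_ ordering (j , inj₂ (ℤ.pred u)) (j , inj₂ u)
  ℤ-⋖ {j} u = ℤ< (pred<self u) , nothing-between
    where
    nothing-between : ∀ w → ¬ Between ordering (j , inj₂ (ℤ.pred u)) w (j , inj₂ u)
    nothing-between _ (block< p , block< q) = ℕ.<-asym p q
    nothing-between _ (block< p , fin<ℤ)    = ℕ.<-irrefl refl p
    nothing-between _ (block< p , ℤ< _)     = ℕ.<-irrefl refl p
    nothing-between _ (ℤ< _     , block< q) = ℕ.<-irrefl refl q
    nothing-between _ (ℤ< p     , ℤ< q)     = ℤ.≤⇒≯ (ℤ.i<j⇒i≤pred[j] q) p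

  ⋖-from-fin : ∀ {j} {x : Fin (size j)} {b} → _⋖_ ordering (j , inj₁ x) b →
               Σ (Fin (size j)) λ y → b ≡ (j , inj₁ y) × toℕ y ≡ suc (toℕ x)
  ⋖-from-fin (block< p , empty) = ⊥-elim (empty (_ , inj₂ 0ℤ) (fin<ℤ , block< p))
  ⋖-from-fin {b = _ , inj₂ u} (fin<ℤ , empty) =
    ⊥-elim (empty (_ , inj₂ (ℤ.pred u)) (fin<ℤ , ℤ< (pred<self u)))
  ⋖-from-fin {j} {x} {_ , inj₁ y} (fin< x<y , empty) with toℕ y ℕ.≟ suc (toℕ x)
  ... | yes y≡1+x = y , refl , y≡1+x
  ... | no y≢1+x = ⊥-elim (empty (j , inj₁ middle) (fin< x<middle , fin< middle<y))
    where
    1+x<y : suc (toℕ x) ℕ.< toℕ y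
    1+x<y = ℕ.≤∧≢⇒< x<y (y≢1+x ∘ sym)
    middle : Fin (size j)
    middle = fromℕ< (ℕ.<-trans 1+x<y (toℕ<n y))
    x<middle : toℕ x ℕ.< toℕ middle
    x<middle = subst (toℕ x ℕ.<_) (sym (toℕ-fromℕ< _)) ℕ.≤-refl
    middle<y : toℕ middle ℕ.< toℕ y
    middle<y = subst (ℕ._< toℕ y) (sym (toℕ-fromℕ< _)) 1+x<y

  NoImmediatePred⇒first : ∀ {x} → NoImmediatePred ordering x →
                          Σ ℕ λ j → Σ (Fin (size j)) λ y → x ≡ (j , inj₁ y) × toℕ y ≡ 0
  NoImmediatePred⇒first {j , inj₂ u} noPred = ⊥-elim (NoImmediatePred⇒¬⋖ ordering noPred (ℤ-⋖ u))
  NoImmediatePred⇒first {j , inj₁ x} noPred with toℕ x in x≡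
  ... | zero = j , x , refl , x≡
  ... | suc t = ⊥-elim (NoImmediatePred⇒¬⋖ ordering noPred
                  (fin-⋖ {y = x} (trans x≡ (cong suc (sym (toℕ-fromℕ< t<size))))))
    where
    t<size : t ℕ.< size j
    t<size = ℕ.<-trans (ℕ.n<1+n t) (subst (ℕ._< size j) x≡ (toℕ<n x))

  chain-positions : ∀ {m} (c : Vector Element (suc m)) {j} {y : Fin (size j)} →
              c zero ≡ (j , inj₁ y) → toℕ y ≡ 0 → (∀ i → _⋖_ ordering (c (inject₁ i)) (c (suc i))) →
              ∀ k → Σ (Fin (size j)) λ z → c k ≡ (j , inj₁ z) × toℕ z ≡ toℕ k
  chain-positions c c₀≡y y≡0 covered zero = _ , c₀≡y , y≡0
  chain-positions {suc m} c c₀≡y y≡0 covered (suc i)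
    with chain-positions (c ∘ inject₁) c₀≡y y≡0 (covered ∘ inject₁) i
  ... | z , cᵢ≡z , z≡i with ⋖-from-fin (subst (λ a → _⋖_ ordering a (c (suc i))) cᵢ≡z (covered i))
  ... | z′ , c≡z′ , z′≡1+z = z′ , c≡z′ , trans z′≡1+z (cong suc z≡i)

  IsBlock⇒size : ∀ {j c} → IsBlock ordering j c → Σ ℕ λ j′ → size j′ ≡ suc j
  IsBlock⇒size {j} {c} (block noPred noSucc covered) with NoImmediatePred⇒first noPred
  ... | j′ , y , c₀≡y , y≡0 with chain-positions c c₀≡y y≡0 covered (fromℕ j)
  ... | z , last≡z , z≡j with size j′ ℕ.≟ suc j
  ...   | yes size≡ = j′ , size≡
  ...   | no size≢ = ⊥-elim (NoImmediateSucc⇒¬⋖ ordering noSucc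
                       (subst (λ a → _⋖_ ordering a (j′ , inj₁ next)) (sym last≡z) (fin-⋖ next≡1+z)))
    where
    z≡j′ : toℕ z ≡ j
    z≡j′ = trans z≡j (toℕ-fromℕ j)
    1+j<size : suc j ℕ.< size j′
    1+j<size = ℕ.≤∧≢⇒< (subst (ℕ._< size j′) z≡j′ (toℕ<n z)) (size≢ ∘ sym)
    next : Fin (size j′)
    next = fromℕ< 1+j<size
    next≡1+z : toℕ next ≡ suc (toℕ z)
    next≡1+z = trans (toℕ-fromℕ< 1+j<size) (cong suc (sym z≡j′))

  ≺-ℤ-above : ∀ {j} t → Σ ℤ λ u → (j , t) ≺ (j , inj₂ u)
  ≺-ℤ-above (inj₁ _) = 0ℤ , fin<ℤ
  ≺-ℤ-above (inj₂ u) = ℤ.suc u , ℤ< (self<suc u)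

  finitePart-block : ∀ {j} → size j ≡ suc j → Σ (Vector Element (suc j)) (IsBlock ordering j)
  finitePart-block {j} size≡ = (λ i → j , inj₁ (cast (sym size≡) i)) , block noPred noSucc covered
    where
    position : ∀ i → toℕ (cast (sym size≡) i) ≡ toℕ i
    position = toℕ-cast (sym size≡)
    noPred : NoImmediatePred ordering (j , inj₁ (cast (sym size≡) zero))
    noPred (j″ , t) (block< j″<j) = (j″ , inj₂ (proj₁ (≺-ℤ-above t))) , proj₂ (≺-ℤ-above t) , block< j″<j
    noPred (_ , inj₁ y) (fin< y<first) = ⊥-elim (ℕ.n≮0 (subst (toℕ y ℕ.<_) (position zero) y<first))
    noSucc : NoImmediateSucc ordering (j , inj₁ (cast (sym size≡) (fromℕ j)))
    noSucc _ (block< j<j″) = (j , inj₂ 0ℤ) , fin<ℤ , block< j<j″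
    noSucc (_ , inj₂ u) fin<ℤ = (j , inj₂ (ℤ.pred u)) , fin<ℤ , ℤ< (pred<self u)
    noSucc (_ , inj₁ y) (fin< last<y) =
      ⊥-elim (ℕ.<-irrefl refl (ℕ.<-≤-trans (subst (toℕ y ℕ.<_) size≡ (toℕ<n y))
                                           (subst (ℕ._< toℕ y) last≡j last<y)))
      where
      last≡j : toℕ (cast (sym size≡) (fromℕ j)) ≡ j
      last≡j = trans (position (fromℕ j)) (toℕ-fromℕ j)
    covered : ∀ i → _⋖_ ordering (j , inj₁ (cast (sym size≡) (inject₁ i))) (j , inj₁ (cast (sym size≡) (suc i)))
    covered i = fin-⋖ (trans (position (suc i)) (cong suc (sym (trans (position (inject₁ i)) (toℕ-inject₁ i)))))

Diagonal : (ℕ → Set) → (ℕ → ℕ) → Set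
Diagonal P size = ∀ j → (size j ≡ 0 × P j) ⊎ (size j ≡ suc j × ¬ P j)

diagonalSize : ExcludedMiddle (Level.suc Level.zero) → (P : ℕ → Set) → Σ (ℕ → ℕ) (Diagonal P)
diagonalSize lem P = proj₁ ∘ decide , proj₂ ∘ decide
  where
  decide : ∀ j → Σ ℕ λ s → (s ≡ 0 × P j) ⊎ (s ≡ suc j × ¬ P j)
  decide j with lem {Lift _ (P j)}
  ... | yes (lift p) = 0 , inj₁ (refl , p)
  ... | no ¬p = suc j , inj₂ (refl , ¬p ∘ lift)

blockSum-≰-diagonal : ExcludedMiddle (Level.suc Level.zero) → (enum : ℕ → LinOrd) (size : ℕ → ℕ) →
                      Diagonal (λ j → satΠ (enum j) (hasBlock j) emptyEnv) size →
                      ∀ n → ¬ BlockSum.ordering size ≤[ 4 ] enum n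
blockSum-≰-diagonal lem enum size spec n A≤eₙ with spec n
... | inj₂ (size≡ , ¬hasBlockₑ) =
  ¬hasBlockₑ (A≤eₙ (hasBlock n) (hasBlock-complete A n (finitePart-block size≡)))
  where open BlockSum size renaming (ordering to A)
... | inj₁ (size≡0 , hasBlockₑ) with hasBlock-sound (enum n) n hasBlockₑ
...   | c , c-block =
  IsBlock⇒¬NotBlock (enum n) c-block (noBlock-sound (enum n) n (A≤eₙ (noBlock n) noBlockₐ) c)
  where
  open BlockSum size renaming (ordering to A)
  ¬block : ∀ {d} → ¬ IsBlock A n d
  ¬block d-block with IsBlock⇒size d-block
  ... | j , size≡ with spec j
  ...   | inj₁ (size≡0′ , _) = ℕ.0≢1+n (trans (sym size≡0′) size≡)
  ...   | inj₂ (size≡′ , _) with ℕ.suc-injective (trans (sym size≡′) size≡)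
  ...     | refl = ℕ.0≢1+n (trans (sym size≡0) size≡)
  noBlockₐ : satΠ A (noBlock n) emptyEnv
  noBlockₐ = noBlock-complete A n λ _ → ¬IsBlock⇒NotBlock A lem ¬block

mainTheorem19 : ExcludedMiddle (Level.suc Level.zero) →
    (K : Class) → IsoInvariant K → CountablyManyTypes K → ¬ UniversalFor-LO 4 K
mainTheorem19 lem K _ (enum , enumerates) universal
  with diagonalSize lem (λ j → satΠ (enum j) (hasBlock j) emptyEnv)
... | size , diagonal with universal (BlockSum.ordering size)
...   | B , B∈K , A≤B with enumerates B B∈K
...     | n , B≅eₙ = blockSum-≰-diagonal lem enum size diagonal n λ φ → ≅⇒≤ B≅eₙ φ ∘ A≤B φ
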